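{- For any $t,k\in\mathbb{N}$ there exists a constant $\ell$ such that the following holds. Let $G$ be a bipartite graph containing no induced cycle $C_{t'}$ for any $t'\ge t$, and with $\mathrm{ch}(G)<k$. Let $\mathcal{Y}$ be any Gyárfás decomposition of $G$. Then $\mathcal{Y}$ has maximum back-degree at most $\ell$.
   Context: Chain-index $\mathrm{ch}(G)$: the largest $k$ such that there are $2k$ distinct vertices $a_1,\dots,a_k,b_1,\dots,b_k$ with, for all $i<j$, $a_ib_j$ an edge and $b_ia_j$ a non-edge. Gyárfás decomposition of a connected bipartite graph $G$: a rooted tree $\mathcal{Y}$ such that (1) each node of $\mathcal{Y}$ is a subset of $V(G)$ (a bag) and the bags partition $V(G)$; write $\mathrm{bag}(v)$ for the bag containing $v$; (2) the root bag is a singleton (the root vertex); (3) if $u,v$ are adjacent then $\mathrm{bag}(u)$ is an ancestor of $\mathrm{bag}(v)$ or vice versa (a bag counts as its own ancestor); (4) for every bag $B$, the subgraph of $G$ induced by $B$ together with all its descendant bags is connected; (5) for every non-root bag $B$ there is a vertex $h(B)$ (the hook of $B$) in the parent bag of $B$ that is adjacent to all vertices of $B$ and to no vertex of the strict descendant bags of $B$. A Gyárfás decomposition of a disconnected bipartite graph is the union of Gyárfás decompositions of its connected components. A bag $B$ has an edge to a bag $B'$ if some vertex of $B$ is adjacent to some vertex of $B'$. The back-degree of $B$ is the number of (strict) ancestor bags of $B$ to which $B$ has an edge; the maximum back-degree of $\mathcal{Y}$ is the maximum back-degree over its bags. -}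

module Defs where

open import Data.Nat using (ℕ; zero; suc; _<_; _≤_)
open import Data.Fin using (Fin; toℕ)
open import Data.Bool using (Bool)
open import Data.Maybe using (Maybe; just; nothing)
open import Data.Product using (Σ; ∃; ∃-syntax; _×_; _,_)
open import Data.Sum using (_⊎_)
open import Relation.Nullary using (¬_)
open import Relation.Binary.PropositionalEquality using (_≡_; _≢_)
open import Function.Definitions using (Injective)

Adj : ℕ → Set₁
Adj n = Fin n → Fin n → Set

IsSimpleGraph : ∀ {n} → Adj n → Set
IsSimpleGraph {n} E = (∀ u v → E u v → E v u) × (∀ u → ¬ E u u)

IsBipartite : ∀ {n} → Adj n → Set
IsBipartite {n} E = Σ (Fin n → Bool) λ c → ∀ u v → E u v → c u ≢ c v

CycAdj : (m : ℕ) → Fin m → Fin m → Set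
CycAdj m i j =
  (suc (toℕ i) ≡ toℕ j) ⊎ (suc (toℕ j) ≡ toℕ i)
  ⊎ ((toℕ i ≡ 0 × suc (toℕ j) ≡ m) ⊎ (toℕ j ≡ 0 × suc (toℕ i) ≡ m))

InducedCycle : ∀ {n} → Adj n → ℕ → Set
InducedCycle {n} E m =
  3 ≤ m × Σ (Fin m → Fin n) λ f →
    Injective _≡_ _≡_ f × (∀ i j → (E (f i) (f j) → CycAdj m i j) × (CycAdj m i j → E (f i) (f j)))

HasChain : ∀ {n} → Adj n → ℕ → Set
HasChain {n} E k =
  Σ (Fin k → Fin n) λ a → Σ (Fin k → Fin n) λ b →
    Injective _≡_ _≡_ a × Injective _≡_ _≡_ b × (∀ i j → a i ≢ b j)
    × (∀ i j → toℕ i < toℕ j → E (a i) (b j) × ¬ E (b i) (a j))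

ChLt : ∀ {n} → Adj n → ℕ → Set
ChLt E k = ∀ k' → HasChain E k' → k' < k

-- Rooted forests of bags: bags are Fin m, parent b = nothing iff b is a root.

module Forest {m : ℕ} (parent : Fin m → Maybe (Fin m)) where

  data Anc : Fin m → Fin m → Set where
    anc-refl : ∀ {a} → Anc a a
    anc-step : ∀ {a b p} → parent b ≡ just p → Anc a p → Anc a b

  StrictAnc : Fin m → Fin m → Set
  StrictAnc a b = Anc a b × a ≢ b

  Acyclic : Set
  Acyclic = ∀ b p → parent b ≡ just p → ¬ Anc b p

data Reach {n} (E : Adj n) (S : Fin n → Set) : Fin n → Fin n → Set where
  here  : ∀ {u} → S u → Reach E S u u
  there : ∀ {u w v} → S u → E u w → Reach E S w v → Reach E S u v

InducedConnected : ∀ {n} → Adj n → (Fin n → Set) → Set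
InducedConnected {n} E S = ∀ u v → S u → S v → Reach E S u v

-- Gyárfás decomposition (of a possibly disconnected bipartite graph: a
-- rooted forest whose trees are Gyárfás decompositions of the components).
-- bag v : the bag containing v (bags partition V(G), every bag nonempty).
record IsGyarfas {n m : ℕ} (E : Adj n) (bag : Fin n → Fin m)
                 (parent : Fin m → Maybe (Fin m)) : Set where
  open Forest parent
  field
    acyclic   : Acyclic
    nonempty  : ∀ B → ∃[ v ] bag v ≡ B
    root-single : ∀ B → parent B ≡ nothing →
                  ∃[ r ] (bag r ≡ B × ∀ v → bag v ≡ B → v ≡ r)
    edge-anc  : ∀ u v → E u v → Anc (bag u) (bag v) ⊎ Anc (bag v) (bag u)
    desc-conn : ∀ B → InducedConnected E (λ v → Anc B (bag v))
    hook      : ∀ B P → parent B ≡ just P →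
                ∃[ h ] (bag h ≡ P × (∀ v → bag v ≡ B → E h v)
                        × (∀ v → StrictAnc B (bag v) → ¬ E h v))

BagEdge : ∀ {n m} → Adj n → (Fin n → Fin m) → Fin m → Fin m → Set
BagEdge E bag B B' = ∃[ u ] ∃[ v ] (bag u ≡ B × bag v ≡ B' × E u v)

MaxBackDegAtMost : ∀ {n m} → Adj n → (Fin n → Fin m) → (Fin m → Maybe (Fin m)) → ℕ → Set
MaxBackDegAtMost {n} {m} E bag parent ℓ =
  ∀ B → (f : Fin (suc ℓ) → Fin m) → Injective _≡_ _≡_ f →
    ¬ (∀ i → StrictAnc (f i) B × BagEdge E bag B (f i))
  where open Forest parent

{-# OPTIONS --safe #-}
-- Fix a bag B with ancestor bags B = A₀, A₁, …; their hooks h₀, h₁, … form an induced path,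
-- and h_u misses every bag strictly below A_u. For a back edge x y with x ∈ B and y ∈ A_s, the
-- first hook adjacent to y has index at most t + 1, since otherwise x, h₀, …, h_u, y is a long
-- induced cycle. Among depths with one residue mod t + 3 and one first hook h_c, for z < r the
-- first hook at or above A_z adjacent to y_r is some h_{z+δ} with δ ≤ t + 1, since otherwise
-- h_c, y_z, h_z, …, h_{z+δ}, y_r is a long induced cycle. An iterated pigeonhole on δ yields
-- depths z₀ < … < z_k with y_{z_j} adjacent to h_{z_i+δ_i} for i < j, while y_{z_i} misses all
-- hooks above A_{z_i}: a chain of size k. Adjacency is only decided under a double negation,
-- which suffices because the conclusion is negative.
module Submission where

open import Defs
open import Data.Nat
open import Data.Nat.Properties
open import Data.Nat.DivMod using (_%_; _/_; m%n<n; m≡m%n+[m/n]*n)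
open import Data.Bool using (if_then_else_)
open import Data.Bool.Properties using (¬-not)
open import Data.Empty using (⊥)
open import Data.Fin as Fin using (Fin; toℕ)
open import Data.Fin.Properties using (toℕ-injective; toℕ<n; any?; injective⇒≤; sequence)
open import Data.Maybe using (Maybe; just; nothing; fromMaybe)
open import Data.List using (List; []; _∷_; length; filter; upTo; lookup)
open import Data.List.Properties using (filter-all)
open import Data.List.Membership.Propositional using (_∈_)
open import Data.List.Membership.Propositional.Properties using (∈-filter⁺; ∈-filter⁻; ∈-upTo⁺)
open import Data.List.Relation.Unary.All as All using (All; []; _∷_)
open import Data.List.Relation.Unary.All.Properties using (all-filter) renaming (filter⁺ to All-filter⁺)
open import Data.List.Relation.Unary.AllPairs using (AllPairs; []; _∷_)
open import Data.List.Relation.Unary.AllPairs.Properties using (applyUpTo⁺₁) renaming (filter⁺ to AllPairs-filter⁺)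
open import Data.List.Relation.Unary.Any using (here; there; index)
open import Data.List.Relation.Unary.Any.Properties using (lookup-index)
open import Data.List.Relation.Binary.Sublist.Propositional.Properties
  using (filter-⊆; length-mono-≤) renaming (filter⁺ to Sublist-filter⁺)
open import Data.Product using (∃-syntax; _×_; _,_; proj₁; proj₂)
open import Data.Sum using (_⊎_; inj₁; inj₂)
open import Effect.Monad using (RawMonad)
open import Function.Base using (_∘_; _∘′_)
open import Function.Bundles using (_⇔_; mk⇔; Equivalence)
open import Function.Definitions using (Injective)
open import Function.Properties.Equivalence using (⇔-isEquivalence)
open import Level using (0ℓ)
open import Relation.Nullary using (¬_; Dec; yes; no; does; contradiction)
open import Relation.Nullary.Decidable using (¬¬-excluded-middle)
open import Relation.Nullary.Negation using (¬¬-Monad)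
open import Relation.Unary using (Pred; Decidable)
open import Relation.Binary using (IsEquivalence; tri<; tri≈; tri>)
open import Relation.Binary.PropositionalEquality

module ⇔ = IsEquivalence (⇔-isEquivalence {ℓ = 0ℓ})
open Equivalence using (to; from)

least : ∀ {P : ℕ → Set} → Decidable P → ℕ → ℕ
least P? zero = zero
least P? (suc b) = if does (P? 0) then zero else suc (least (P? ∘ suc) b)

least-spec : ∀ {P : ℕ → Set} (P? : Decidable P) {b} → P b →
             P (least P? b) × least P? b ≤ b × (∀ {i} → i < least P? b → ¬ P i)
least-spec P? {zero} Pb = Pb , z≤n , λ ()
least-spec P? {suc b} Pb with P? 0
... | yes P0 = P0 , z≤n , λ ()
... | no ¬P0 with least-spec (P? ∘ suc) Pb
...   | Pu , u≤b , below = Pu , s≤s u≤b , λ { {zero} _ → ¬P0 ; {suc i} (s≤s i<u) → below i<u }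

module _ {A : Set} where

  length-≤-filter+filter : ∀ {P Q : Pred A 0ℓ} (P? : Decidable P) (Q? : Decidable Q) {xs} →
    All (λ x → P x ⊎ Q x) xs → length xs ≤ length (filter P? xs) + length (filter Q? xs)
  length-≤-filter+filter P? Q? [] = z≤n
  length-≤-filter+filter P? Q? {x ∷ xs} (Px⊎Qx ∷ rest) with P? x | Q? x | Px⊎Qx
  ... | yes _ | yes _ | _ = s≤s (≤-trans (length-≤-filter+filter P? Q? rest) (+-monoʳ-≤ _ (n≤1+n _)))
  ... | yes _ | no _  | _ = s≤s (length-≤-filter+filter P? Q? rest)
  ... | no _  | yes _ | _ = ≤-trans (s≤s (length-≤-filter+filter P? Q? rest)) (≤-reflexive (sym (+-suc _ _)))
  ... | no ¬P | no ¬Q | inj₁ P = contradiction P ¬P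
  ... | no ¬P | no ¬Q | inj₂ Q = contradiction Q ¬Q

  allPairs-zipWith : ∀ {P : Pred A 0ℓ} {R R′ : A → A → Set} {xs} →
    (∀ {x y} → P x → P y → R x y → R′ x y) → All P xs → AllPairs R xs → AllPairs R′ xs
  allPairs-zipWith f [] [] = []
  allPairs-zipWith f (Px ∷ Pxs) (Rx ∷ Rxs) =
    All.zipWith (λ (Py , Rxy) → f Px Py Rxy) (Pxs , Rx) ∷ allPairs-zipWith f Pxs Rxs

module _ {A : Set} (col : A → ℕ) where

  colourClass : ℕ → List A → List A
  colourClass c = filter (λ x → col x ≟ c)

  colourClass-⊆ : ∀ c xs → All (λ x → col x ≡ c) (colourClass c xs)
  colourClass-⊆ c = all-filter (λ x → col x ≟ c)

  length-colourClass-filter : ∀ {P : Pred A 0ℓ} (P? : Decidable P) c xs →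
                              length (colourClass c (filter P? xs)) ≤ length (colourClass c xs)
  length-colourClass-filter P? c xs = length-mono-≤ (Sublist-filter⁺ _ _ (λ { refl p → p }) (filter-⊆ P? xs))

  pigeonhole : ∀ T xs → All (λ x → col x ≤ T) xs →
               ∃[ c ] c ≤ T × length xs ≤ suc T * length (colourClass c xs)
  pigeonhole zero xs cols = 0 , z≤n , ≤-reflexive (begin
    length xs                       ≡⟨ cong length (filter-all _ (All.map n≤0⇒n≡0 cols)) ⟨
    length (colourClass 0 xs)       ≡⟨ *-identityˡ _ ⟨
    1 * length (colourClass 0 xs)   ∎)
    where open ≡-Reasoning
  pigeonhole (suc T) xs cols = choose (pigeonhole T lower (all-filter (λ x → col x ≤? T) xs))
    where
    top = colourClass (suc T) xs
    lower = filter (λ x → col x ≤? T) xs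

    split : length xs ≤ length top + length lower
    split = length-≤-filter+filter _ _ (All.map (λ le → top⊎lower (m≤n⇒m<n∨m≡n le)) cols)
      where top⊎lower : ∀ {a} → a < suc T ⊎ a ≡ suc T → a ≡ suc T ⊎ a ≤ T
            top⊎lower (inj₁ lt) = inj₂ (≤-pred lt)
            top⊎lower (inj₂ eq) = inj₁ eq

    choose : ∃[ c ] c ≤ T × length lower ≤ suc T * length (colourClass c lower) →
             ∃[ c ] c ≤ suc T × length xs ≤ suc (suc T) * length (colourClass c xs)
    choose (c , c≤T , lower≤) with length top ≤? length (colourClass c xs)
    ... | yes top≤ = c , m≤n⇒m≤1+n c≤T , ≤-trans split (+-mono-≤ top≤ lower≤[c])
      where
      lower≤[c] : length lower ≤ suc T * length (colourClass c xs)
      lower≤[c] = ≤-trans lower≤ (*-monoʳ-≤ (suc T) (length-colourClass-filter _ c xs))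
    ... | no top≰ = suc T , ≤-refl , ≤-trans split (+-monoʳ-≤ (length top) lower≤[top])
      where
      lower≤[top] : length lower ≤ suc T * length top
      lower≤[top] = ≤-trans lower≤ (*-monoʳ-≤ (suc T)
        (≤-trans (length-colourClass-filter _ c xs) (<⇒≤ (≰⇒> top≰))))

tower : ℕ → ℕ → ℕ
tower T zero = zero
tower T (suc K) = suc (suc T * tower T K)

HeadColoured : ∀ {A : Set} → (A → ℕ → A → Set) → A × ℕ → A × ℕ → Set
HeadColoured R (z , c) (r , _) = R z c r

module _ {A : Set} (T : ℕ) (col : A → A → ℕ) (R : A → ℕ → A → Set) where

  iteratedPigeonhole : ∀ K xs → tower T K ≤ length xs →
    AllPairs (λ z r → col z r ≤ T × R z (col z r) r) xs →
    ∃[ os ] K ≤ length os × AllPairs (HeadColoured R) os × All (λ o → proj₁ o ∈ xs) os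
  iteratedPigeonhole zero xs _ _ = [] , z≤n , [] , []
  iteratedPigeonhole (suc K) (z ∷ rest) (s≤s big) (fromZ ∷ pairs)
    with c , _ , rest≤ ← pigeonhole (col z) T rest (All.map proj₁ fromZ)
    with os , K≤ , osPairs , os∈ ← iteratedPigeonhole K (colourClass (col z) c rest)
           (*-cancelˡ-≤ (suc T) (≤-trans big rest≤)) (AllPairs-filter⁺ _ pairs)
    = (z , c) ∷ os , s≤s K≤ , All.map fromHead os∈ ∷ osPairs ,
      here refl ∷ All.map (there ∘ proj₁ ∘ ∈-filter⁻ (λ r → col z r ≟ c) {xs = rest}) os∈
    where
    fromHead : ∀ {r} → r ∈ colourClass (col z) c rest → R z c r
    fromHead r∈ with r∈rest , refl ← ∈-filter⁻ (λ r → col z r ≟ c) r∈ = proj₂ (All.lookup fromZ r∈rest)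

upperBound : ∀ {K} (g : Fin K → ℕ) → ∃[ N ] (∀ i → g i < N)
upperBound {zero} g = 0 , λ ()
upperBound {suc K} g with N , g<N ← upperBound (g ∘ Fin.suc) =
  suc (g Fin.zero) ⊔ N , λ { Fin.zero → m≤m⊔n _ N ; (Fin.suc i) → ≤-trans (g<N i) (m≤n⊔m _ N) }

module _ {P Q : Pred ℕ 0ℓ} (P? : Decidable P) (Q⇒P : ∀ {x y} → x < y → Q y → P x) where

  sorted-length-≤-suc-filter : ∀ {xs} → AllPairs _<_ xs → All Q xs → length xs ≤ suc (length (filter P? xs))
  sorted-length-≤-suc-filter [] [] = z≤n
  sorted-length-≤-suc-filter (_ ∷ []) (_ ∷ []) = s≤s z≤n
  sorted-length-≤-suc-filter {x ∷ y ∷ ys} ((x<y ∷ _) ∷ sorted) (_ ∷ Qy ∷ Qys) with P? x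
  ... | yes _ = s≤s (sorted-length-≤-suc-filter sorted (Qy ∷ Qys))
  ... | no ¬Px = contradiction (Q⇒P x<y Qy) ¬Px

module _ {K : ℕ} (g : Fin K → ℕ) where

  InImage : ℕ → Set
  InImage s = ∃[ i ] g i ≡ s

  inImage? : Decidable InImage
  inImage? s = any? (λ i → g i ≟ s)

  length-image-list : Injective _≡_ _≡_ g → ∀ N → (∀ i → g i < N) → K ≤ length (filter inImage? (upTo N))
  length-image-list g-injective N g<N = injective⇒≤ {f = position} position-injective
    where
    image-list = filter inImage? (upTo N)
    g∈ : ∀ i → g i ∈ image-list
    g∈ i = ∈-filter⁺ inImage? (∈-upTo⁺ (g<N i)) (i , refl)
    position : Fin K → Fin (length image-list)
    position = index ∘ g∈
    position-injective : Injective _≡_ _≡_ position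
    position-injective {i} {j} eq = g-injective (begin
      g i                          ≡⟨ lookup-index (g∈ i) ⟩
      lookup image-list (position i) ≡⟨ cong (lookup image-list) eq ⟩
      lookup image-list (position j) ≡⟨ lookup-index (g∈ j) ⟨
      g j                          ∎)
      where open ≡-Reasoning

sortedImageBelowMax : ∀ {K} (g : Fin (suc K) → ℕ) → Injective _≡_ _≡_ g →
  ∃[ xs ] AllPairs _<_ xs × K ≤ length xs × All (λ s → InImage g s × ∃[ j ] s < g j) xs
sortedImageBelowMax {K} g g-injective =
  filter below? images ,
  AllPairs-filter⁺ below? images-sorted ,
  ≤-pred (≤-trans (length-image-list g g-injective N g<N)
                  (sorted-length-≤-suc-filter below? (λ { x<y (j , refl) → j , x<y }) images-sorted images-inImage)) ,
  All.zip (All-filter⁺ below? images-inImage , all-filter below? images)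
  where
  N = proj₁ (upperBound g)
  g<N = proj₂ (upperBound g)
  images = filter (inImage? g) (upTo N)
  images-sorted : AllPairs _<_ images
  images-sorted = AllPairs-filter⁺ (inImage? g) (applyUpTo⁺₁ (λ s → s) N (λ lt _ → lt))
  images-inImage : All (InImage g) images
  images-inImage = all-filter (inImage? g) (upTo N)
  below? : Decidable (λ s → ∃[ j ] s < g j)
  below? s = any? (λ j → s <? g j)

m%d≡n%d∧m<n⇒m+d≤n : ∀ d .{{_ : NonZero d}} {m n} → m % d ≡ n % d → m < n → m + d ≤ n
m%d≡n%d∧m<n⇒m+d≤n d {m} {n} m%d≡n%d m<n = begin
  m + d                   ≡⟨ cong (_+ d) (m≡m%n+[m/n]*n m d) ⟩
  m % d + m / d * d + d   ≡⟨ +-assoc (m % d) _ d ⟩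
  m % d + (m / d * d + d) ≡⟨ cong (m % d +_) (+-comm _ d) ⟩
  m % d + suc (m / d) * d ≤⟨ +-monoʳ-≤ (m % d) (*-monoˡ-≤ d m/d<n/d) ⟩
  m % d + n / d * d       ≡⟨ cong (_+ n / d * d) m%d≡n%d ⟩
  n % d + n / d * d       ≡⟨ m≡m%n+[m/n]*n n d ⟨
  n                       ∎
  where
  open ≤-Reasoning
  m/d<n/d : m / d < n / d
  m/d<n/d = *-cancelʳ-< d _ _ (+-cancelˡ-< (m % d) _ _ (begin-strict
    m % d + m / d * d ≡⟨ m≡m%n+[m/n]*n m d ⟨
    m                 <⟨ m<n ⟩
    n                 ≡⟨ m≡m%n+[m/n]*n n d ⟩
    n % d + n / d * d ≡⟨ cong (_+ n / d * d) m%d≡n%d ⟨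
    m % d + n / d * d ∎))

module _ {A : Set} (default : A) where

  nth : List A → ℕ → A
  nth [] _ = default
  nth (x ∷ xs) zero = x
  nth (x ∷ xs) (suc i) = nth xs i

  nth-∈ : ∀ {xs i} → i < length xs → nth xs i ∈ xs
  nth-∈ {x ∷ xs} {zero} _ = here refl
  nth-∈ {x ∷ xs} {suc i} (s≤s i<n) = there (nth-∈ i<n)

  nth-allPairs : ∀ {R : A → A → Set} {xs i j} → AllPairs R xs → i < j → j < length xs → R (nth xs i) (nth xs j)
  nth-allPairs {i = zero} {suc j} (Rx ∷ _) _ (s≤s j<n) = All.lookup Rx (nth-∈ j<n)
  nth-allPairs {i = suc i} {suc j} (_ ∷ Rxs) (s≤s i<j) (s≤s j<n) = nth-allPairs Rxs i<j j<n

strictlyIncreasing-injective : ∀ {K} {h : ℕ → ℕ} → (∀ {i j} → i < j → j ≤ K → h i < h j) →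
                               ∀ {i j} → i ≤ K → j ≤ K → h i ≡ h j → i ≡ j
strictlyIncreasing-injective increasing {i} {j} i≤K j≤K hi≡hj with <-cmp i j
... | tri< i<j _ _ = contradiction hi≡hj (<⇒≢ (increasing i<j j≤K))
... | tri≈ _ i≡j _ = i≡j
... | tri> _ _ j<i = contradiction (sym hi≡hj) (<⇒≢ (increasing j<i i≤K))


Consecutive : ℕ → ℕ → Set
Consecutive i j = suc i ≡ j ⊎ suc j ≡ i

consecutive-sym : ∀ {i j} → Consecutive i j ⇔ Consecutive j i
consecutive-sym = mk⇔ swap swap
  where
  swap : ∀ {i j} → Consecutive i j → Consecutive j i
  swap (inj₁ e) = inj₂ e
  swap (inj₂ e) = inj₁ e

consecutive-suc : ∀ {i j} → Consecutive (suc i) (suc j) ⇔ Consecutive i j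
consecutive-suc = mk⇔ (λ { (inj₁ e) → inj₁ (suc-injective e) ; (inj₂ e) → inj₂ (suc-injective e) })
                      (λ { (inj₁ e) → inj₁ (cong suc e) ; (inj₂ e) → inj₂ (cong suc e) })

private
  separated : ∀ {p i j} → 3 ≤ p → i < j → j ≤ p → ¬ (∀ {k} → k ≤ p → Consecutive i k ⇔ Consecutive j k)
  separated {p} {i} {j} 3≤p i<j j≤p same with to (same (≤-trans i<j j≤p)) (inj₁ refl)
  ... | inj₁ j+1≡i+1 = <⇒≢ i<j (sym (suc-injective j+1≡i+1))
  separated {i = zero} 3≤p _ _ same | inj₂ refl with from (same 3≤p) (inj₁ refl)
  ... | inj₁ ()
  ... | inj₂ ()
  separated {i = suc i} _ _ j≤p same | inj₂ refl with to (same (≤-trans (m≤n+m i 3) j≤p)) (inj₂ refl)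
  ... | inj₁ i+4≡i = m+1+n≢n 3 i+4≡i
  ... | inj₂ i+1≡i+3 = m+1+n≢n 1 (sym (suc-injective i+1≡i+3))

consecutive-neighbourhood-injective : ∀ {p i j} → 3 ≤ p → i ≤ p → j ≤ p →
  (∀ {k} → k ≤ p → Consecutive i k ⇔ Consecutive j k) → i ≡ j
consecutive-neighbourhood-injective {p} {i} {j} 3≤p i≤p j≤p same with <-cmp i j
... | tri≈ _ i≡j _ = i≡j
... | tri< i<j _ _ = contradiction (λ {k} → same {k}) (separated 3≤p i<j j≤p)
... | tri> _ _ j<i = contradiction (λ {k} → ⇔.sym ∘ same {k}) (separated 3≤p j<i i≤p)

-- Defs.CycAdj m i j is definitionally Cyclic m (toℕ i) (toℕ j)
Cyclic : ℕ → ℕ → ℕ → Set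
Cyclic m i j = suc i ≡ j ⊎ suc j ≡ i ⊎ ((i ≡ 0 × suc j ≡ m) ⊎ (j ≡ 0 × suc i ≡ m))

cyclic-sym : ∀ {m i j} → Cyclic m i j ⇔ Cyclic m j i
cyclic-sym = mk⇔ swap swap
  where
  swap : ∀ {m i j} → Cyclic m i j → Cyclic m j i
  swap (inj₁ e) = inj₂ (inj₁ e)
  swap (inj₂ (inj₁ e)) = inj₁ e
  swap (inj₂ (inj₂ (inj₁ e))) = inj₂ (inj₂ (inj₂ e))
  swap (inj₂ (inj₂ (inj₂ e))) = inj₂ (inj₂ (inj₁ e))

cyclic-suc : ∀ {m i j} → Cyclic m (suc i) (suc j) ⇔ Consecutive i j
cyclic-suc = mk⇔ (λ { (inj₁ e) → inj₁ (suc-injective e) ; (inj₂ (inj₁ e)) → inj₂ (suc-injective e)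
                    ; (inj₂ (inj₂ (inj₁ (() , _)))) ; (inj₂ (inj₂ (inj₂ (() , _)))) })
                 (λ { (inj₁ e) → inj₁ (cong suc e) ; (inj₂ e) → inj₂ (inj₁ (cong suc e)) })

cyclic-zero-suc : ∀ {p j} → Cyclic (suc (suc p)) 0 (suc j) ⇔ (j ≡ 0 ⊎ j ≡ p)
cyclic-zero-suc = mk⇔ (λ { (inj₁ e) → inj₁ (sym (suc-injective e)) ; (inj₂ (inj₁ ()))
                         ; (inj₂ (inj₂ (inj₁ (_ , e)))) → inj₂ (suc-injective (suc-injective e))
                         ; (inj₂ (inj₂ (inj₂ (() , _)))) })
                      (λ { (inj₁ refl) → inj₁ refl ; (inj₂ refl) → inj₂ (inj₂ (inj₁ (refl , refl))) })

cyclic-zero-zero : ∀ {p} → ¬ Cyclic (suc (suc p)) 0 0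
cyclic-zero-zero (inj₁ ())
cyclic-zero-zero (inj₂ (inj₁ ()))
cyclic-zero-zero (inj₂ (inj₂ (inj₁ (_ , ()))))
cyclic-zero-zero (inj₂ (inj₂ (inj₂ (_ , ()))))

_◃_ : ∀ {A : Set} → A → (ℕ → A) → ℕ → A
(v ◃ g) zero = v
(v ◃ g) (suc k) = g k

module InducedPaths {n : ℕ} (E : Adj n) (simple : IsSimpleGraph E) where

  private
    E-sym : ∀ {u v} → E u v ⇔ E v u
    E-sym = mk⇔ (proj₁ simple _ _) (proj₁ simple _ _)

  IsInducedPath : (ℕ → Fin n) → ℕ → Set
  IsInducedPath g p = ∀ {i j} → i ≤ p → j ≤ p → E (g i) (g j) ⇔ Consecutive i j

  private
    ◃-front : ∀ {g : ℕ → Fin n} {p v} → E v (g 0) → (∀ {k} → 0 < k → k ≤ p → ¬ E v (g k)) →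
              ∀ {j} → j ≤ p → E v (g j) ⇔ Consecutive 0 (suc j)
    ◃-front v~g₀ _ {zero} _ = mk⇔ (λ _ → inj₁ refl) (λ _ → v~g₀)
    ◃-front _ v≁g {suc j} j≤p = mk⇔ (λ e → contradiction e (v≁g (s≤s z≤n) j≤p)) (λ { (inj₁ ()) ; (inj₂ ()) })

  ◃-inducedPath : ∀ {g : ℕ → Fin n} {p v} → IsInducedPath g p → E v (g 0) → (∀ {k} → 0 < k → k ≤ p → ¬ E v (g k)) →
                  IsInducedPath (v ◃ g) (suc p)
  ◃-inducedPath {v = v} _ _ _ {zero} {zero} _ _ =
    mk⇔ (λ e → contradiction e (proj₂ simple v)) (λ { (inj₁ ()) ; (inj₂ ()) })
  ◃-inducedPath {g} {p} {v} _ v~g₀ v≁g {zero} {suc j} _ (s≤s j≤p) = ◃-front {g} {p} {v} v~g₀ v≁g j≤p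
  ◃-inducedPath {g} {p} {v} _ v~g₀ v≁g {suc i} {zero} (s≤s i≤p) _ =
    ⇔.trans E-sym (⇔.trans (◃-front {g} {p} {v} v~g₀ v≁g i≤p) consecutive-sym)
  ◃-inducedPath path _ _ {suc i} {suc j} (s≤s i≤p) (s≤s j≤p) =
    ⇔.trans (path i≤p j≤p) (⇔.sym consecutive-suc)

  inducedPath-injective : ∀ {g : ℕ → Fin n} {p i j} → 3 ≤ p → IsInducedPath g p → i ≤ p → j ≤ p → g i ≡ g j → i ≡ j
  inducedPath-injective {g} 3≤p path i≤p j≤p gi≡gj =
    consecutive-neighbourhood-injective 3≤p i≤p j≤p λ {k} k≤p →
      ⇔.trans (⇔.sym (path i≤p k≤p)) (⇔.trans (mk⇔ (subst (λ x → E x (g k)) gi≡gj)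
                                                   (subst (λ x → E x (g k)) (sym gi≡gj))) (path j≤p k≤p))

  inducedCycle-close : ∀ {g : ℕ → Fin n} {p w} → 3 ≤ p → IsInducedPath g p → E w (g 0) → E w (g p) →
                       (∀ {k} → 0 < k → k < p → ¬ E w (g k)) → InducedCycle E (suc (suc p))
  inducedCycle-close {g} {p} {w} 3≤p path w~g₀ w~gₚ w≁g =
    ≤-trans 3≤p (≤-trans (n≤1+n p) (n≤1+n _)) ,
    c ∘ toℕ ,
    (λ e → toℕ-injective (c-injective (≤-pred (toℕ<n _)) (≤-pred (toℕ<n _)) e)) ,
    λ i j → let i~j = c-adjacency (≤-pred (toℕ<n i)) (≤-pred (toℕ<n j)) in to i~j , from i~j
    where
    c = w ◃ g

    ends : ∀ {k} → k ≤ p → E w (g k) ⇔ (k ≡ 0 ⊎ k ≡ p)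
    ends {zero} _ = mk⇔ (λ _ → inj₁ refl) (λ _ → w~g₀)
    ends {suc k} k≤p with m≤n⇒m<n∨m≡n k≤p
    ... | inj₁ k<p = mk⇔ (λ e → contradiction e (w≁g (s≤s z≤n) k<p)) (λ { (inj₁ ()) ; (inj₂ refl) → contradiction k<p (<-irrefl refl) })
    ... | inj₂ refl = mk⇔ (λ _ → inj₂ refl) (λ _ → w~gₚ)

    c-adjacency : ∀ {i j} → i ≤ suc p → j ≤ suc p → E (c i) (c j) ⇔ Cyclic (suc (suc p)) i j
    c-adjacency {zero} {zero} _ _ =
      mk⇔ (λ e → contradiction e (proj₂ simple w)) (λ e → contradiction e cyclic-zero-zero)
    c-adjacency {zero} {suc j} _ (s≤s j≤p) = ⇔.trans (ends j≤p) (⇔.sym cyclic-zero-suc)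
    c-adjacency {suc i} {zero} (s≤s i≤p) _ =
      ⇔.trans E-sym (⇔.trans (ends i≤p) (⇔.trans (⇔.sym cyclic-zero-suc) cyclic-sym))
    c-adjacency {suc i} {suc j} (s≤s i≤p) (s≤s j≤p) = ⇔.trans (path i≤p j≤p) (⇔.sym cyclic-suc)

    w-off-path : ∀ {k} → k ≤ p → w ≢ g k
    w-off-path k≤p w≡gk with to (path k≤p z≤n) (subst (λ x → E x (g 0)) w≡gk w~g₀)
    ... | inj₁ ()
    ... | inj₂ refl with to (path k≤p ≤-refl) (subst (λ x → E x (g p)) w≡gk w~gₚ)
    ...   | inj₁ 2≡p = contradiction (subst (3 ≤_) (sym 2≡p) 3≤p) λ { (s≤s (s≤s ())) }
    ...   | inj₂ p+1≡1 = contradiction (subst (3 ≤_) (suc-injective p+1≡1) 3≤p) λ ()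

    c-injective : ∀ {i j} → i ≤ suc p → j ≤ suc p → c i ≡ c j → i ≡ j
    c-injective {zero} {zero} _ _ _ = refl
    c-injective {zero} {suc j} _ (s≤s j≤p) e = contradiction e (w-off-path j≤p)
    c-injective {suc i} {zero} (s≤s i≤p) _ e = contradiction (sym e) (w-off-path i≤p)
    c-injective {suc i} {suc j} (s≤s i≤p) (s≤s j≤p) e = cong suc (inducedPath-injective 3≤p path i≤p j≤p e)

module GyarfasAncestry {n m : ℕ} {E : Adj n} {bag : Fin n → Fin m} {parent : Fin m → Maybe (Fin m)}
                       (simple : IsSimpleGraph E) (gyarfas : IsGyarfas E bag parent) (B : Fin m) where
  open Forest parent
  open IsGyarfas gyarfas
  open InducedPaths E simple

  ancestor : ℕ → Fin m
  ancestor zero = B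
  ancestor (suc s) = fromMaybe (ancestor s) (parent (ancestor s))

  HasParent : ℕ → Set
  HasParent s = parent (ancestor s) ≡ just (ancestor (suc s))

  Anc-trans : ∀ {a b c} → Anc a b → Anc b c → Anc a c
  Anc-trans a≤b anc-refl = a≤b
  Anc-trans a≤b (anc-step e b≤p) = anc-step e (Anc-trans a≤b b≤p)

  ancestor-Anc : ∀ {s w} → s ≤ w → Anc (ancestor w) (ancestor s)
  ancestor-Anc = go ∘′ ≤⇒≤′
    where
    go : ∀ {s w} → s ≤′ w → Anc (ancestor w) (ancestor s)
    go ≤′-refl = anc-refl
    go {w = suc w} (≤′-step s≤w) with parent (ancestor w) in e
    ... | just p = Anc-trans (anc-step e anc-refl) (go s≤w)
    ... | nothing = go s≤w

  ancestor-root : ∀ {s w} → parent (ancestor s) ≡ nothing → s ≤ w → ancestor w ≡ ancestor s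
  ancestor-root {s} root = go ∘′ ≤⇒≤′
    where
    go : ∀ {w} → s ≤′ w → ancestor w ≡ ancestor s
    go ≤′-refl = refl
    go {suc w} (≤′-step s≤w) rewrite go s≤w | root = refl

  hasParent-mono : ∀ {u w} → u ≤ w → HasParent w → HasParent u
  hasParent-mono {u} u≤w hasParent with parent (ancestor u) in root
  ... | just p = refl
  ... | nothing = contradiction (trans (sym hasParent) (trans (cong parent (ancestor-root root u≤w)) root)) λ ()

  hasParent-below : ∀ {s w} → s < w → ancestor s ≢ ancestor w → HasParent s
  hasParent-below {s} s<w s≢w with parent (ancestor s) in root
  ... | just p = refl
  ... | nothing = contradiction (sym (ancestor-root root (<⇒≤ s<w))) s≢w

  private
    ancestor-strict : ∀ {u w} → HasParent u → u < w → ancestor u ≢ ancestor w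
    ancestor-strict {u} hasParent u<w u≡w =
      acyclic (ancestor u) (ancestor (suc u)) hasParent (subst (λ a → Anc a (ancestor (suc u))) (sym u≡w) (ancestor-Anc u<w))

  ancestor-injective : ∀ {u w} → HasParent w → ancestor u ≡ ancestor w → u ≡ w
  ancestor-injective {u} {w} hasParent u≡w with <-cmp u w
  ... | tri< u<w _ _ = contradiction u≡w (ancestor-strict (hasParent-mono (<⇒≤ u<w) hasParent) u<w)
  ... | tri≈ _ eq _ = eq
  ... | tri> _ _ w<u = contradiction (sym u≡w) (ancestor-strict hasParent w<u)

  private
    Anc-ancestor : ∀ {a b} s → Anc a b → b ≡ ancestor s → ∃[ d ] ancestor (d + s) ≡ a
    Anc-ancestor s anc-refl refl = 0 , refl
    Anc-ancestor s (anc-step {p = p} parent≡p a≤p) refl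
      with d , e ← Anc-ancestor (suc s) a≤p (sym (cong (fromMaybe (ancestor s)) parent≡p))
      = suc d , trans (cong ancestor (sym (+-suc d s))) e

  Anc⇒ancestor : ∀ {a} → Anc a B → ∃[ d ] ancestor d ≡ a
  Anc⇒ancestor a≤B with d , e ← Anc-ancestor 0 a≤B refl = d , trans (cong ancestor (sym (+-identityʳ d))) e

  private
    HookSpec : ℕ → Fin n → Set
    HookSpec u h = bag h ≡ ancestor (suc u) × (∀ v → bag v ≡ ancestor u → E h v)
                   × (∀ v → StrictAnc (ancestor u) (bag v) → ¬ E h v)

    hookOf : ∀ u (mp : Maybe (Fin m)) → parent (ancestor u) ≡ mp → Fin n
    hookOf u (just p) e = proj₁ (hook (ancestor u) p e)
    hookOf u nothing _ = proj₁ (nonempty B)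

    hookOf-spec : ∀ u mp (e : parent (ancestor u) ≡ mp) → mp ≡ just (ancestor (suc u)) → HookSpec u (hookOf u mp e)
    hookOf-spec u (just p) e refl = proj₂ (hook (ancestor u) p e)

  -- a junk vertex once the u-th ancestor of B is a root
  hookAt : ℕ → Fin n
  hookAt u = hookOf u (parent (ancestor u)) refl

  hook-bag : ∀ {u} → HasParent u → bag (hookAt u) ≡ ancestor (suc u)
  hook-bag {u} hasParent = proj₁ (hookOf-spec u _ refl hasParent)

  hook-adjacent : ∀ {u v} → HasParent u → bag v ≡ ancestor u → E (hookAt u) v
  hook-adjacent {u} {v} hasParent = proj₁ (proj₂ (hookOf-spec u _ refl hasParent)) v

  hook-nonadjacent : ∀ {u v s} → HasParent u → bag v ≡ ancestor s → s < u → ¬ E (hookAt u) v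
  hook-nonadjacent {u} {v} {s} hasParent v∈s s<u = proj₂ (proj₂ (hookOf-spec u _ refl hasParent)) v
    (subst (StrictAnc (ancestor u)) (sym v∈s)
      (ancestor-Anc (<⇒≤ s<u) , λ e → <⇒≢ s<u (ancestor-injective hasParent (sym e))))

  hooks-adjacent : ∀ {u} → HasParent (suc u) → E (hookAt u) (hookAt (suc u))
  hooks-adjacent {u} hasParent =
    proj₁ simple _ _ (hook-adjacent hasParent (hook-bag (hasParent-mono (n≤1+n u) hasParent)))

  hooks-nonadjacent : ∀ {u w} → HasParent w → suc u < w → ¬ E (hookAt u) (hookAt w)
  hooks-nonadjacent {u} hasParent u+1<w e =
    hook-nonadjacent hasParent (hook-bag (hasParent-mono (<⇒≤ (≤-trans (n≤1+n _) u+1<w)) hasParent)) u+1<w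
      (proj₁ simple _ _ e)

  hooks-inducedPath : ∀ {b q} → HasParent (b + q) → IsInducedPath (λ k → hookAt (b + k)) q
  hooks-inducedPath {b} {q} hasParent {i} {j} i≤q j≤q = mk⇔ adjacent⇒consecutive consecutive⇒adjacent
    where
    hasParentAt : ∀ {k} → k ≤ q → HasParent (b + k)
    hasParentAt k≤q = hasParent-mono (+-monoʳ-≤ b k≤q) hasParent

    step : ∀ {k} → suc k ≤ q → E (hookAt (b + k)) (hookAt (b + suc k))
    step {k} k<q rewrite +-suc b k = hooks-adjacent (subst HasParent (+-suc b k) (hasParentAt k<q))

    far : ∀ {k l} → suc k < l → l ≤ q → ¬ E (hookAt (b + k)) (hookAt (b + l))
    far {k} {l} k+1<l l≤q = hooks-nonadjacent (hasParentAt l≤q) (subst (_< b + l) (+-suc b k) (+-monoʳ-< b k+1<l))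

    adjacent⇒consecutive : E (hookAt (b + i)) (hookAt (b + j)) → Consecutive i j
    adjacent⇒consecutive e with <-cmp i j
    ... | tri≈ _ refl _ = contradiction e (proj₂ simple _)
    ... | tri< i<j _ _ with m≤n⇒m<n∨m≡n i<j
    ...   | inj₁ i+1<j = contradiction e (far i+1<j j≤q)
    ...   | inj₂ i+1≡j = inj₁ i+1≡j
    adjacent⇒consecutive e | tri> _ _ j<i with m≤n⇒m<n∨m≡n j<i
    ...   | inj₁ j+1<i = contradiction (proj₁ simple _ _ e) (far j+1<i i≤q)
    ...   | inj₂ j+1≡i = inj₂ j+1≡i

    consecutive⇒adjacent : Consecutive i j → E (hookAt (b + i)) (hookAt (b + j))
    consecutive⇒adjacent (inj₁ refl) = step j≤q
    consecutive⇒adjacent (inj₂ refl) = proj₁ simple _ _ (step i≤q)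

commonNeighbour-nonadjacent : ∀ {n} {E : Adj n} → IsBipartite E → ∀ {a b h} → E a h → E b h → ¬ E a b
commonNeighbour-nonadjacent (_ , proper) a~h b~h a~b =
  proper _ _ a~b (trans (¬-not (proper _ _ a~h)) (sym (¬-not (proper _ _ b~h))))

-- Depths in one residue class mod spacing t are far enough apart for the hooks between
-- them; the factors t + 2 and the tower pay for the pigeonholes on firstHook and hookOffset.
spacing : ℕ → ℕ
spacing t = 3 + t

backDegreeBound : ℕ → ℕ → ℕ
backDegreeBound t k = spacing t * (suc (suc t) * suc (tower (suc t) (suc k)))

module BackDegree (t k : ℕ) {n m : ℕ} {E : Adj n} {bag : Fin n → Fin m} {parent : Fin m → Maybe (Fin m)}
                  (simple : IsSimpleGraph E) (bipartite : IsBipartite E)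
                  (noLongHoles : ∀ t' → t ≤ t' → ¬ InducedCycle E t') (chainsBelow : ChLt E k)
                  (gyarfas : IsGyarfas E bag parent) (E? : ∀ u v → Dec (E u v))
                  (B : Fin m) (f : Fin (suc (backDegreeBound t k)) → Fin m) (f-injective : Injective _≡_ _≡_ f)
                  (backEdges : ∀ i → Forest.StrictAnc parent (f i) B × BagEdge E bag B (f i)) where

  open Forest parent
  open InducedPaths E simple
  open GyarfasAncestry simple gyarfas B

  S = spacing t
  ℓ = backDegreeBound t k

  E-sym : ∀ {u v} → E u v → E v u
  E-sym = proj₁ simple _ _

  edge : ∀ i → BagEdge E bag B (f i)
  edge i = proj₂ (backEdges i)

  x y : Fin (suc ℓ) → Fin n
  x i = proj₁ (edge i)
  y i = proj₁ (proj₂ (edge i))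

  x-bag : ∀ i → bag (x i) ≡ B
  x-bag i = proj₁ (proj₂ (proj₂ (edge i)))

  x~y : ∀ i → E (x i) (y i)
  x~y i = proj₂ (proj₂ (proj₂ (proj₂ (edge i))))

  depth : Fin (suc ℓ) → ℕ
  depth i = proj₁ (Anc⇒ancestor (proj₁ (proj₁ (backEdges i))))

  ancestor-depth : ∀ i → ancestor (depth i) ≡ f i
  ancestor-depth i = proj₂ (Anc⇒ancestor (proj₁ (proj₁ (backEdges i))))

  y-bag : ∀ i → bag (y i) ≡ ancestor (depth i)
  y-bag i = trans (proj₁ (proj₂ (proj₂ (proj₂ (edge i))))) (sym (ancestor-depth i))

  depth-injective : Injective _≡_ _≡_ depth
  depth-injective {i} {j} e = f-injective (trans (sym (ancestor-depth i)) (trans (cong ancestor e) (ancestor-depth j)))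

  -- opaque: unfolding the search over Fin (suc ℓ) makes unification blow up
  opaque
    indexAt : ℕ → Fin (suc ℓ)
    indexAt s with inImage? depth s
    ... | yes (i , _) = i
    ... | no _ = Fin.zero

    indexAt-depth : ∀ {s} → InImage depth s → depth (indexAt s) ≡ s
    indexAt-depth {s} img with inImage? depth s
    ... | yes (_ , e) = e
    ... | no ¬img = contradiction img ¬img

  xAt yAt : ℕ → Fin n
  xAt = x ∘ indexAt
  yAt = y ∘ indexAt

  xAt-bag : ∀ s → bag (xAt s) ≡ ancestor 0
  xAt-bag s = x-bag (indexAt s)

  xAt~yAt : ∀ s → E (xAt s) (yAt s)
  xAt~yAt s = x~y (indexAt s)

  yAt-bag : ∀ {s} → InImage depth s → bag (yAt s) ≡ ancestor s
  yAt-bag img = trans (y-bag _) (cong ancestor (indexAt-depth img))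

  BackDepth : ℕ → Set
  BackDepth s = InImage depth s × HasParent s

  firstHook : ℕ → ℕ
  firstHook s = least (λ u → E? (yAt s) (hookAt u)) s

  firstHook-spec : ∀ {s} → BackDepth s → E (yAt s) (hookAt (firstHook s)) × firstHook s ≤ s
                   × (∀ {i} → i < firstHook s → ¬ E (yAt s) (hookAt i))
  firstHook-spec (img , hasParent) = least-spec (λ u → E? _ (hookAt u)) (E-sym (hook-adjacent hasParent (yAt-bag img)))

  firstHook-bound : ∀ {s} → BackDepth s → firstHook s ≤ suc t
  firstHook-bound {s} back with firstHook s ≤? suc t | firstHook-spec back
  ... | yes u≤t | _ = u≤t
  ... | no u≰t | y~hᵤ , u≤s , y≁h = contradiction hole (noLongHoles _ (≤-trans (≤-trans (n≤1+n t) (<⇒≤ t+1<u)) (m≤n+m u 3)))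
    where
    u = firstHook s
    t+1<u = ≰⇒> u≰t
    hasParentAt : ∀ {k} → k ≤ u → HasParent k
    hasParentAt k≤u = hasParent-mono (≤-trans k≤u u≤s) (proj₂ back)
    -- x, then the hooks of the ancestors 0, …, u of B, closed up by y
    path : IsInducedPath (xAt s ◃ hookAt) (suc u)
    path = ◃-inducedPath {hookAt} {u} {xAt s} (hooks-inducedPath {0} {u} (hasParentAt ≤-refl))
        (E-sym (hook-adjacent (hasParentAt z≤n) (xAt-bag s)))
        (λ 0<k k≤u → hook-nonadjacent (hasParentAt k≤u) (xAt-bag s) 0<k ∘ E-sym)
    y-off-path : ∀ {k} → 0 < k → k < suc u → ¬ E (yAt s) ((xAt s ◃ hookAt) k)
    y-off-path {suc k} _ (s≤s k<u) = y≁h k<u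
    hole : InducedCycle E (3 + u)
    hole = inducedCycle-close {xAt s ◃ hookAt} {suc u} {yAt s} (s≤s (≤-trans (s≤s (s≤s z≤n)) t+1<u)) path
      (E-sym (xAt~yAt s)) y~hᵤ y-off-path

  hookOffset : ℕ → ℕ → ℕ
  hookOffset z r = least (λ d → E? (yAt r) (hookAt (z + d))) (r ∸ z)

  hookOffset-spec : ∀ {z r} → BackDepth r → z ≤ r → E (yAt r) (hookAt (z + hookOffset z r)) × hookOffset z r ≤ r ∸ z
                    × (∀ {d} → d < hookOffset z r → ¬ E (yAt r) (hookAt (z + d)))
  hookOffset-spec {z} {r} (img , hasParent) z≤r = least-spec (λ d → E? _ (hookAt (z + d)))
    (subst (λ w → E (yAt r) (hookAt w)) (sym (m+[n∸m]≡n z≤r)) (E-sym (hook-adjacent hasParent (yAt-bag img))))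

  hookOffset-bound : ∀ {z r} → BackDepth z → BackDepth r → firstHook z ≡ firstHook r → 2 + firstHook z ≤ z → z ≤ r →
                     hookOffset z r ≤ suc t
  hookOffset-bound {z} {r} z-back r-back same-first c+2≤z z≤r with hookOffset z r ≤? suc t | hookOffset-spec r-back z≤r
  ... | yes δ≤t | _ = δ≤t
  ... | no δ≰t | yᵣ~h , δ≤r-z , yᵣ≁h =
    contradiction hole (noLongHoles _ (≤-trans (≤-trans (n≤1+n t) (<⇒≤ t+1<δ)) (m≤n+m δ 4)))
    where
    c = firstHook z
    δ = hookOffset z r
    t+1<δ = ≰⇒> δ≰t
    hasParentAt : ∀ {k} → k ≤ δ → HasParent (z + k)
    hasParentAt k≤δ = hasParent-mono (≤-trans (+-monoʳ-≤ z (≤-trans k≤δ δ≤r-z)) (≤-reflexive (m+[n∸m]≡n z≤r)))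
                                     (proj₂ r-back)
    yz~hc : E (yAt z) (hookAt c)
    yz~hc = proj₁ (firstHook-spec z-back)
    yr~hc : E (yAt r) (hookAt c)
    yr~hc = subst (λ w → E (yAt r) (hookAt w)) (sym same-first) (proj₁ (firstHook-spec r-back))
    -- the hook at c, then y_z, then the hooks of the ancestors z, …, z + δ of B, closed up by y_r
    hole : InducedCycle E (4 + δ)
    hole = inducedCycle-close (s≤s (s≤s (≤-trans (s≤s z≤n) t+1<δ)))
      (◃-inducedPath
        (◃-inducedPath (hooks-inducedPath {z} {δ} (hasParentAt ≤-refl))
          (E-sym (hook-adjacent (hasParentAt z≤n) (subst (λ w → bag (yAt z) ≡ ancestor w) (sym (+-identityʳ z)) (yAt-bag (proj₁ z-back)))))
          (λ 0<k k≤δ → hook-nonadjacent (hasParentAt k≤δ) (yAt-bag (proj₁ z-back)) (m<m+n z 0<k) ∘ E-sym))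
        (E-sym yz~hc)
        (λ { {suc k} _ (s≤s k≤δ) → hooks-nonadjacent (hasParentAt k≤δ) (≤-trans c+2≤z (m≤m+n z k)) }))
      yr~hc yᵣ~h
      (λ { {suc zero} _ _ → commonNeighbour-nonadjacent bipartite yr~hc yz~hc
         ; {suc (suc k)} _ (s≤s (s≤s k<δ)) → yᵣ≁h k<δ })

  Linked : ℕ → ℕ → ℕ → Set
  Linked z δ r = z + S ≤ r × δ ≤ suc t × E (yAt r) (hookAt (z + δ))

  module ChainTemplate (z δ : ℕ → ℕ) (back : ∀ {i} → i ≤ k → BackDepth (z i))
                       (linked : ∀ {i j} → i < j → j ≤ k → Linked (z i) (δ i) (z j)) where

    u : ℕ → ℕ
    u i = z i + δ i

    u+1<z : ∀ {i j} → i < j → j ≤ k → suc (u i) < z j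
    u+1<z {i} {j} i<j j≤k = begin
      suc (suc (z i + δ i)) ≡⟨ cong suc (+-suc (z i) (δ i)) ⟨
      suc (z i + suc (δ i)) ≡⟨ +-suc (z i) (suc (δ i)) ⟨
      z i + suc (suc (δ i)) ≤⟨ +-monoʳ-≤ (z i) (s≤s (s≤s δ≤t)) ⟩
      z i + S               ≤⟨ z+S≤z ⟩
      z j                   ∎
      where
      open ≤-Reasoning
      z+S≤z = proj₁ (linked i<j j≤k)
      δ≤t = proj₁ (proj₂ (linked i<j j≤k))

    z-increasing : ∀ {i j} → i < j → j ≤ k → z i < z j
    z-increasing {i} i<j j≤k = ≤-trans (s≤s (m≤m+n (z i) (δ i))) (<⇒≤ (u+1<z i<j j≤k))

    u-increasing : ∀ {i j} → i < j → j ≤ k → u i < u j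
    u-increasing i<j j≤k = <-≤-trans (<-trans (n<1+n _) (u+1<z i<j j≤k)) (m≤m+n _ _)

    y-bag-z : ∀ {i} → i ≤ k → bag (yAt (z i)) ≡ ancestor (z i)
    y-bag-z i≤k = yAt-bag (proj₁ (back i≤k))

    hasParent-z : ∀ {i} → i ≤ k → HasParent (z i)
    hasParent-z i≤k = proj₂ (back i≤k)

    hasParent-u : ∀ {i} → i < k → HasParent (suc (u i))
    hasParent-u i<k = hasParent-mono (<⇒≤ (u+1<z (n<1+n _) i<k)) (hasParent-z i<k)

    hasParent-hook : ∀ {i} → i < k → HasParent (u i)
    hasParent-hook {i} i<k = hasParent-mono {u i} (n≤1+n _) (hasParent-u i<k)

    a b : Fin k → Fin n
    a α = hookAt (u (toℕ α))
    b α = yAt (z (toℕ α))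

    a-bag : ∀ {i} → i < k → bag (hookAt (u i)) ≡ ancestor (suc (u i))
    a-bag i<k = hook-bag (hasParent-hook i<k)

    a-injective : Injective _≡_ _≡_ a
    a-injective {α} {β} e = toℕ-injective (strictlyIncreasing-injective u-increasing
      (<⇒≤ (toℕ<n α)) (<⇒≤ (toℕ<n β))
      (suc-injective (ancestor-injective (hasParent-u (toℕ<n β))
        (trans (sym (a-bag (toℕ<n α))) (trans (cong bag e) (a-bag (toℕ<n β)))))))

    b-injective : Injective _≡_ _≡_ b
    b-injective {α} {β} e = toℕ-injective (strictlyIncreasing-injective z-increasing
      (<⇒≤ (toℕ<n α)) (<⇒≤ (toℕ<n β))
      (ancestor-injective (hasParent-z (<⇒≤ (toℕ<n β)))
        (trans (sym (y-bag-z (<⇒≤ (toℕ<n α)))) (trans (cong bag e) (y-bag-z (<⇒≤ (toℕ<n β)))))))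

    a≢b : ∀ {i j} → i < k → j ≤ k → hookAt (u i) ≢ yAt (z j)
    a≢b {i} {j} i<k j≤k e with ancestor-injective (hasParent-z j≤k)
                                 (trans (sym (a-bag i<k)) (trans (cong bag e) (y-bag-z j≤k)))
    ... | u+1≡z with <-cmp i j
    ...   | tri< i<j _ _ = <⇒≢ (u+1<z i<j j≤k) u+1≡z
    ...   | tri≈ _ refl _ = <⇒≢ (s≤s (m≤m+n (z i) (δ i))) (sym u+1≡z)
    ...   | tri> _ _ j<i = <⇒≢ (<-trans (<-≤-trans (z-increasing j<i (<⇒≤ i<k)) (m≤m+n _ _)) (n<1+n _)) (sym u+1≡z)

    edges : ∀ α β → toℕ α < toℕ β → E (a α) (b β) × ¬ E (b α) (a β)
    edges α β α<β =
      E-sym (proj₂ (proj₂ (linked α<β β≤k))) ,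
      hook-nonadjacent (hasParent-hook (toℕ<n β)) (y-bag-z (<⇒≤ (toℕ<n α)))
        (<-≤-trans (z-increasing α<β β≤k) (m≤m+n _ _)) ∘ E-sym
      where β≤k = <⇒≤ (toℕ<n β)

    chain : HasChain E k
    chain = a , b , a-injective , b-injective , (λ α β → a≢b (toℕ<n α) (<⇒≤ (toℕ<n β))) , edges

  backDepths : ∃[ ds ] AllPairs _<_ ds × ℓ ≤ length ds × All BackDepth ds
  backDepths with ds , sorted , ℓ≤ , props ← sortedImageBelowMax depth depth-injective =
    ds , sorted , ℓ≤ , All.map backDepth props
    where
    backDepth : ∀ {s} → InImage depth s × ∃[ j ] s < depth j → BackDepth s
    backDepth ((i , refl) , j , dᵢ<dⱼ) = (i , refl) , hasParent-below dᵢ<dⱼ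
      (λ e → <⇒≢ dᵢ<dⱼ (cong depth (f-injective (trans (sym (ancestor-depth i)) (trans e (ancestor-depth j))))))

  Spaced : ℕ → ℕ → Set
  Spaced a b = a + S ≤ b

  Cluster : ℕ → List ℕ → Set
  Cluster c zs = AllPairs Spaced zs × All (λ z → BackDepth z × firstHook z ≡ c) zs

  SpacedDepths : ℕ → Set
  SpacedDepths N = ∃[ zs ] N ≤ length zs × AllPairs Spaced zs × All BackDepth zs

  spacedDepths : SpacedDepths (suc (suc t) * suc (tower (suc t) (suc k)))
  spacedDepths = inResidueClass backDepths
    where
    inResidueClass : ∃[ ds ] AllPairs _<_ ds × ℓ ≤ length ds × All BackDepth ds →
                     SpacedDepths (suc (suc t) * suc (tower (suc t) (suc k)))
    inResidueClass (ds , sorted , ℓ≤ , backDepth) = pick (pigeonhole (_% S) (suc (suc t)) ds residues)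
      where
      residues : All (λ s → s % S ≤ suc (suc t)) ds
      residues = All.tabulate (λ {s} _ → ≤-pred (m%n<n s S))

      pick : ∃[ r ] r ≤ suc (suc t) × length ds ≤ S * length (colourClass (_% S) r ds) →
             SpacedDepths (suc (suc t) * suc (tower (suc t) (suc k)))
      pick (r , _ , ds≤) =
        colourClass (_% S) r ds , *-cancelˡ-≤ S (≤-trans ℓ≤ ds≤) ,
        allPairs-zipWith (λ a≡r b≡r a<b → m%d≡n%d∧m<n⇒m+d≤n S (trans a≡r (sym b≡r)) a<b)
          (colourClass-⊆ (_% S) r ds) (AllPairs-filter⁺ (λ s → s % S ≟ r) sorted) ,
        All-filter⁺ (λ s → s % S ≟ r) backDepth

  cluster : ∃[ c ] c ≤ suc t × ∃[ zs ] suc (tower (suc t) (suc k)) ≤ length zs × Cluster c zs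
  cluster = withFirstHook spacedDepths
    where
    withFirstHook : SpacedDepths (suc (suc t) * suc (tower (suc t) (suc k))) →
                    ∃[ c ] c ≤ suc t × ∃[ zs ] suc (tower (suc t) (suc k)) ≤ length zs × Cluster c zs
    withFirstHook (zs , long , spaced , backDepth) = pick (pigeonhole firstHook (suc t) zs (All.map firstHook-bound backDepth))
      where
      pick : ∃[ c ] c ≤ suc t × length zs ≤ suc (suc t) * length (colourClass firstHook c zs) →
             ∃[ c ] c ≤ suc t × ∃[ zs ] suc (tower (suc t) (suc k)) ≤ length zs × Cluster c zs
      pick (c , c≤t , zs≤) =
        c , c≤t , colourClass firstHook c zs , *-cancelˡ-≤ (suc (suc t)) (≤-trans long zs≤) ,
        AllPairs-filter⁺ (λ s → firstHook s ≟ c) spaced ,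
        All.zip (All-filter⁺ (λ s → firstHook s ≟ c) backDepth , colourClass-⊆ firstHook c zs)

  chainFromCluster : ∀ {c zs} → c ≤ suc t → tower (suc t) (suc k) ≤ length zs → AllPairs Spaced zs →
                     All (λ z → (BackDepth z × firstHook z ≡ c) × S ≤ z) zs → HasChain E k
  chainFromCluster {c} {zs} c≤t long spaced props = fromSelection (iteratedPigeonhole (suc t) hookOffset Linked (suc k) zs long linkedPairs)
    where
    linkedPairs : AllPairs (λ z r → hookOffset z r ≤ suc t × Linked z (hookOffset z r) r) zs
    linkedPairs = allPairs-zipWith
      (λ { ((z-back , refl) , S≤z) ((r-back , same) , _) z+S≤r →
         let z≤r = ≤-trans (m≤m+n _ S) z+S≤r
             δ≤t = hookOffset-bound z-back r-back (sym same) (≤-trans (s≤s (s≤s c≤t)) S≤z) z≤r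
         in δ≤t , z+S≤r , δ≤t , proj₁ (hookOffset-spec r-back z≤r) })
      props spaced

    fromSelection : ∃[ os ] suc k ≤ length os × AllPairs (HeadColoured Linked) os × All (λ o → proj₁ o ∈ zs) os → HasChain E k
    fromSelection (os , k+1≤ , linkedOs , os⊆zs) = ChainTemplate.chain (proj₁ ∘ nth (0 , 0) os) (proj₂ ∘ nth (0 , 0) os)
      (λ i≤k → proj₁ (proj₁ (All.lookup props (All.lookup os⊆zs (nth-∈ (0 , 0) (≤-trans (s≤s i≤k) k+1≤))))))
      (λ i<j j≤k → nth-allPairs (0 , 0) linkedOs i<j (≤-trans (s≤s j≤k) k+1≤))

  absurd : ⊥
  absurd = fromCluster cluster
    where
    fromCluster : ∃[ c ] c ≤ suc t × ∃[ zs ] suc (tower (suc t) (suc k)) ≤ length zs × Cluster c zs → ⊥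
    fromCluster (c , c≤t , z₀ ∷ zs , s≤s long , z₀-spaced ∷ spaced , _ ∷ props) =
      <-irrefl refl (chainsBelow k (chainFromCluster c≤t long spaced beyondSpacing))
      where
      beyondSpacing : All (λ z → (BackDepth z × firstHook z ≡ c) × S ≤ z) zs
      beyondSpacing = All.zipWith (λ (p , z₀+S≤z) → p , ≤-trans (m≤n+m S z₀) z₀+S≤z) (props , z₀-spaced)

adjacency-decidable : ∀ {n} (E : Adj n) → ¬ ¬ (∀ u v → Dec (E u v))
adjacency-decidable E = sequence rawApplicative λ _ → sequence rawApplicative λ _ → ¬¬-excluded-middle
  where open RawMonad ¬¬-Monad

lemma3p5 : (t k : ℕ) → ∃[ ℓ ] ((n : ℕ) (E : Adj n) → IsSimpleGraph E → IsBipartite E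
    → (∀ t' → t ≤ t' → ¬ InducedCycle E t') → ChLt E k
    → (m : ℕ) (bag : Fin n → Fin m) (parent : Fin m → Maybe (Fin m))
    → IsGyarfas E bag parent → MaxBackDegAtMost E bag parent ℓ)
lemma3p5 t k = backDegreeBound t k ,
  λ n E simple bipartite noLongHoles chainsBelow m bag parent gyarfas B f f-injective backEdges →
    adjacency-decidable E λ E? →
      BackDegree.absurd t k simple bipartite noLongHoles chainsBelow gyarfas E? B f f-injective backEdges
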